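{- Fix $k\in\mathbb{N}$. Then the sequence $(\Gamma(n^k,(n+1)^k))_{n\ge1}$ is eventually $1,2,1,2,\ldots$. More precisely, let $g(x)$ be the polynomial $\left(\sum_{i=1}^k x^{i-1}\right)^k \bmod x^k$ (i.e., the sum of the terms of degree at most $k-1$ of this polynomial). When $k$ is odd, let $M_k$ be the smallest positive integer such that $0<n^k-g(n)<n^k$ and $0<g(-n)<n^k$ for all $n\ge M_k$; when $k$ is even, let $M_k$ be the smallest positive integer such that $0<n^k+g(-n)<n^k$ and $0<g(n)<n^k$ for all $n\ge M_k$. Then there is $n_0\le M_k+1$ such that $(\Gamma(n^k,(n+1)^k))_{n\ge n_0}$ is $1,2,1,2,\ldots$.
   Context: $\mathbb{N}$ denotes the positive integers. For coprime $a,b\in\mathbb{N}$, consider the equations (E1) $ax+by=\frac{(a-1)(b-1)}{2}$ and (E2) $ax+by+1=\frac{(a-1)(b-1)}{2}$. We say the pair $(a,b)$ uses (E1) if (E1) has a solution in nonnegative integers $x,y$. For arbitrary $a,b\in\mathbb{N}$ with $d=\gcd(a,b)$, define $\Gamma(a,b)=1$ if the coprime pair $(a/d,b/d)$ uses (E1), and $\Gamma(a,b)=2$ otherwise. -}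

module Defs where

open import Data.Nat as ℕ using (ℕ; zero; suc; _∸_; ⌊_/2⌋; _≤_)
open import Data.Nat.DivMod using (_/_)
open import Data.Nat.GCD using (gcd)
open import Data.Nat.Divisibility using (_∣_)
open import Data.Integer as ℤ using (ℤ; +_)
open import Data.List using (List; []; _∷_; take; replicate)
open import Data.Product using (Σ; _×_; _,_; ∃₂)
open import Data.Sum using (_⊎_)
open import Relation.Binary.PropositionalEquality using (_≡_)
open import Relation.Nullary using (¬_)

-- (E1) for a pair (a,b):  a x + b y = (a-1)(b-1)/2  with x, y ∈ ℕ.
-- For coprime a, b the number (a-1)(b-1) is even, so ⌊_/2⌋ is exact.
UsesE1 : ℕ → ℕ → Set
UsesE1 a b = ∃₂ λ x y → a ℕ.* x ℕ.+ b ℕ.* y ≡ ⌊ (a ∸ 1) ℕ.* (b ∸ 1) /2⌋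

reduce : ℕ → ℕ → ℕ × ℕ
reduce a b with gcd a b
... | zero  = a , b
... | suc d = a / suc d , b / suc d

UsesE1ᵣ : ℕ → ℕ → Set
UsesE1ᵣ a b with reduce a b
... | a' , b' = UsesE1 a' b'

ΓIs : ℕ → ℕ → ℕ → Set
ΓIs a b v = (v ≡ 1 × UsesE1ᵣ a b) ⊎ (v ≡ 2 × ¬ UsesE1ᵣ a b)

-- Polynomials with natural coefficients, as coefficient lists
-- (lowest degree first).

Poly : Set
Poly = List ℕ

_⊕_ : Poly → Poly → Poly
[] ⊕ q = q
(p ∷ ps) ⊕ [] = p ∷ ps
(p ∷ ps) ⊕ (q ∷ qs) = (p ℕ.+ q) ∷ (ps ⊕ qs)

scale : ℕ → Poly → Poly
scale c [] = []
scale c (q ∷ qs) = (c ℕ.* q) ∷ scale c qs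

_⊗_ : Poly → Poly → Poly
[] ⊗ q = []
(p ∷ ps) ⊗ q = scale p q ⊕ (0 ∷ (ps ⊗ q))

_^ₚ_ : Poly → ℕ → Poly
p ^ₚ zero = 1 ∷ []
p ^ₚ suc n = p ⊗ (p ^ₚ n)

eval : Poly → ℤ → ℤ
eval [] x = + 0
eval (c ∷ cs) x = + c ℤ.+ x ℤ.* eval cs x

geomSum : ℕ → Poly
geomSum k = replicate k 1

gPoly : ℕ → Poly
gPoly k = take k (geomSum k ^ₚ k)

g : ℕ → ℤ → ℤ
g k = eval (gPoly k)

CondAt : ℕ → ℕ → Set
CondAt k n with (+ n) ℤ.^ k | g k (+ n) | g k (ℤ.- (+ n))
... | nk | gn | gmn =
  (¬ (2 ∣ k) → (+ 0 ℤ.< nk ℤ.- gn × nk ℤ.- gn ℤ.< nk) × (+ 0 ℤ.< gmn × gmn ℤ.< nk))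
  × (2 ∣ k → (+ 0 ℤ.< nk ℤ.+ gmn × nk ℤ.+ gmn ℤ.< nk) × (+ 0 ℤ.< gn × gn ℤ.< nk))

CondFrom : ℕ → ℕ → Set
CondFrom k M = ∀ n → M ≤ n → CondAt k n

IsM : ℕ → ℕ → Set
IsM k M = 1 ≤ M × CondFrom k M × (∀ m → 1 ≤ m → CondFrom k m → M ≤ m)

module Submission where

-- Let G = 1 + x + ⋯ + x^(k-1). Then (1 - x)^k G^k = (1 - x^k)^k ≡ 1 (mod x^k), and
-- g ≡ G^k (mod x^k), so (1 - x)^k g(x) ≡ 1 (mod x^k). At x = -n and at x = n + 1 this
-- says that g(-n) inverts (n+1)^k modulo n^k and that ±g(n+1) inverts n^k modulo
-- (n+1)^k; the inequalities defining M_k say precisely that these inverses, shifted by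
-- n^k or (n+1)^k when the sign requires it, already lie strictly between 0 and the modulus.
-- For coprime a, b with b odd and a α ≡ 1 (mod b), 0 < α < b, the pair (a, b) uses (E1)
-- exactly when α is odd. Since g(x) ≡ g(1) (mod 2) for odd x and exactly one of n, n + 1
-- is odd, the parity of the inverse is that of n + k + g(1), so Γ alternates from M_k on.
-- Finally M_k exists: all coefficients of g are positive, so the inequalities hold as
-- soon as n exceeds g(1), the sum of the coefficients.

open import Defs
open import Data.Nat as ℕ using (ℕ; zero; suc; _≤_; _<_; z≤n; s≤s; _∸_; _%_; ⌊_/2⌋)
import Data.Nat.Properties as ℕP
open import Data.Nat.Divisibility
  using (_∣_; _∣?_; divides; ∣1⇒≡1; ∣m+n∣m⇒∣n; m∣m*n; ∣n⇒∣m*n; ∣⇒≤; ∣-trans)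
open import Data.Nat.DivMod using (n/1≡n; [m+kn]%n≡m%n; m*n%n≡0; %-remove-+ʳ)
open import Data.Nat.GCD using (gcd)
open import Data.Nat.Coprimality as Coprime using (Coprime; coprime⇒gcd≡1; coprime-divisor)
open import Data.Integer as ℤ using (ℤ; +_; -_; -[1+_])
import Data.Integer.Properties as ℤP
open import Data.List using ([]; _∷_; take; drop)
open import Data.Product using (Σ; ∃; ∃₂; _×_; _,_; proj₁; proj₂)
open import Data.Sum using (_⊎_; inj₁; inj₂)
open import Function using (id; _∘_)
open import Relation.Binary.Bundles using (Setoid)
open import Relation.Binary.Structures using (IsEquivalence)
open import Relation.Binary.PropositionalEquality
open import Relation.Nullary using (¬_; contradiction; Dec; yes; no; ¬?; _×-dec_; _→-dec_)
open import Relation.Unary using (Decidable)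

module _ where
  open import Data.Nat using (_+_; _*_; _^_)
  open import Data.Nat.Tactic.RingSolver using (solve-∀)

  data Parity : ℕ → Set where
    even : ∀ i → Parity (2 * i)
    odd  : ∀ i → Parity (1 + 2 * i)

  parity : ∀ n → Parity n
  parity zero = even 0
  parity (suc n) with parity n
  ... | even i = odd i
  ... | odd i  = subst Parity (ℕP.*-suc 2 i) (even (suc i))

  2∣2*i : ∀ i → 2 ∣ 2 * i
  2∣2*i i = divides i (ℕP.*-comm 2 i)

  2∤1+2*i : ∀ i → ¬ 2 ∣ 1 + 2 * i
  2∤1+2*i i 2∣1+2i =
    contradiction (∣1⇒≡1 (∣m+n∣m⇒∣n (subst (2 ∣_) (ℕP.+-comm 1 (2 * i)) 2∣1+2i) (2∣2*i i))) λ ()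

  2∣-or-2∣suc : ∀ n → 2 ∣ n ⊎ 2 ∣ suc n
  2∣-or-2∣suc n with parity n
  ... | even i = inj₁ (2∣2*i i)
  ... | odd i  = inj₂ (subst (2 ∣_) (ℕP.*-suc 2 i) (2∣2*i (suc i)))

  [1+2i]%2≡1 : ∀ i → (1 + 2 * i) % 2 ≡ 1
  [1+2i]%2≡1 i = trans (cong (λ m → suc m % 2) (ℕP.*-comm 2 i)) ([m+kn]%n≡m%n 1 i 2)

  [2i]%2≡0 : ∀ i → (2 * i) % 2 ≡ 0
  [2i]%2≡0 i = trans (cong (_% 2) (ℕP.*-comm 2 i)) (m*n%n≡0 i 2)

  [2+2i]%2≡0 : ∀ i → (2 + 2 * i) % 2 ≡ 0
  [2+2i]%2≡0 i = trans (cong (_% 2) (sym (ℕP.*-suc 2 i))) ([2i]%2≡0 (suc i))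

  odd-^ : ∀ i k → ∃ λ q → (1 + 2 * i) ^ k ≡ 1 + 2 * q
  odd-^ i zero    = 0 , refl
  odd-^ i (suc k) with odd-^ i k
  ... | q , eq = q + i + 2 * i * q , trans (cong ((1 + 2 * i) *_) eq) (lemma i q)
    where
    lemma : ∀ i q → (1 + 2 * i) * (1 + 2 * q) ≡ 1 + 2 * (q + i + 2 * i * q)
    lemma = solve-∀

-- Γ of a coprime pair from a modular inverse

module _ where
  open import Data.Nat using (_+_; _*_)
  open import Data.Nat.Tactic.RingSolver using (solve-∀)

  UsesE1ᵣ≡UsesE1 : ∀ {a b} → Coprime a b → UsesE1ᵣ a b ≡ UsesE1 a b
  UsesE1ᵣ≡UsesE1 {a} {b} coprime with gcd a b | coprime⇒gcd≡1 coprime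
  ... | .1 | refl = cong₂ UsesE1 (n/1≡n a) (n/1≡n b)

  ΓIs-uses : ∀ {a b} → Coprime a b → UsesE1 a b → ΓIs a b 1
  ΓIs-uses coprime uses = inj₁ (refl , subst id (sym (UsesE1ᵣ≡UsesE1 coprime)) uses)

  ΓIs-¬uses : ∀ {a b} → Coprime a b → ¬ UsesE1 a b → ΓIs a b 2
  ΓIs-¬uses coprime ¬uses = inj₂ (refl , ¬uses ∘ subst id (UsesE1ᵣ≡UsesE1 coprime))

  UsesE1-sym : ∀ {a b} → UsesE1 a b → UsesE1 b a
  UsesE1-sym {a} {b} (x , y , eq) =
    y , x , trans (ℕP.+-comm (b * y) (a * x)) (trans eq (cong ⌊_/2⌋ (ℕP.*-comm (a ∸ 1) (b ∸ 1))))

  ΓIs-swap : ∀ {a b v} → Coprime a b → ΓIs b a v → ΓIs a b v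
  ΓIs-swap {a} {b} coprime (inj₁ (refl , uses))  =
    ΓIs-uses coprime (UsesE1-sym {b} {a} (subst id (UsesE1ᵣ≡UsesE1 (Coprime.sym coprime)) uses))
  ΓIs-swap {a} {b} coprime (inj₂ (refl , ¬uses)) =
    ΓIs-¬uses coprime (¬uses ∘ subst id (sym (UsesE1ᵣ≡UsesE1 (Coprime.sym coprime))) ∘ UsesE1-sym {a} {b})

  inverse⇒coprime : ∀ {a b α t} → a * α ≡ 1 + b * t → Coprime a b
  inverse⇒coprime {a} {b} {α} {t} inverse {i} (i∣a , i∣b) =
    ∣1⇒≡1 (∣m+n∣m⇒∣n i∣b*t+1 (∣-trans i∣b (m∣m*n t)))
    where
    i∣b*t+1 : i ∣ b * t + 1
    i∣b*t+1 = subst (i ∣_) (trans inverse (ℕP.+-comm 1 (b * t))) (∣-trans i∣a (m∣m*n α))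

  inverse⇒quotient< : ∀ {a b α t} → a * α ≡ 1 + b * t → α < b → t < a
  inverse⇒quotient< {zero} ()
  inverse⇒quotient< {a@(suc _)} {b} {α} {t} inverse α<b = ℕP.*-cancelˡ-< b t a (begin-strict
    b * t     <⟨ ℕP.n<1+n (b * t) ⟩
    1 + b * t ≡⟨ inverse ⟨
    a * α     <⟨ ℕP.*-monoʳ-< a α<b ⟩
    a * b     ≡⟨ ℕP.*-comm a b ⟩
    b * a     ∎)
    where open ℕP.≤-Reasoning

  ⌊[a-1]*2q/2⌋≡q*[a-1] : ∀ a q → ⌊ (a ∸ 1) * (1 + 2 * q ∸ 1) /2⌋ ≡ q * (a ∸ 1)
  ⌊[a-1]*2q/2⌋≡q*[a-1] a q = trans (cong ⌊_/2⌋ (lemma (a ∸ 1) q)) (sym (ℕP.n≡⌊n+n/2⌋ (q * (a ∸ 1))))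
    where
    lemma : ∀ x q → x * (2 * q) ≡ q * x + q * x
    lemma = solve-∀

  odd-inverse-balance : ∀ t s p q → (suc t + s) * (1 + 2 * p) ≡ 1 + (1 + 2 * q) * t →
    2 * ((suc t + s) * p) + s ≡ 2 * (q * t)
  odd-inverse-balance t s p q inverse = ℕP.+-cancelˡ-≡ (suc t) _ _ (begin
    suc t + (2 * ((suc t + s) * p) + s) ≡⟨ lemma t s p ⟩
    (suc t + s) * (1 + 2 * p)           ≡⟨ inverse ⟩
    1 + (1 + 2 * q) * t                 ≡⟨ lemma′ t q ⟩
    suc t + 2 * (q * t)                 ∎)
    where
    open ≡-Reasoning
    lemma : ∀ t s p → suc t + (2 * ((suc t + s) * p) + s) ≡ (suc t + s) * (1 + 2 * p)
    lemma = solve-∀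
    lemma′ : ∀ t q → 1 + (1 + 2 * q) * t ≡ suc t + 2 * (q * t)
    lemma′ = solve-∀

  -- Writing a = 1 + t + s, the balance makes s even, and x = p, y = s / 2 is a solution.
  usesE1-of-odd-inverse : ∀ {a t} p q → a * (1 + 2 * p) ≡ 1 + (1 + 2 * q) * t → t < a →
    UsesE1 a (1 + 2 * q)
  usesE1-of-odd-inverse {t = t} p q inverse t<a with ℕP.m≤n⇒∃[o]m+o≡n t<a
  ... | s , refl with ∣m+n∣m⇒∣n (subst (2 ∣_) (sym (odd-inverse-balance t s p q inverse)) (2∣2*i (q * t)))
                                (2∣2*i ((suc t + s) * p))
  ... | divides r refl = p , r , trans (ℕP.*-cancelˡ-≡ _ _ 2 (begin
    2 * (a * p + (1 + 2 * q) * r)         ≡⟨ lemma a p q r ⟩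
    2 * (a * p) + r * 2 + 2 * (2 * q * r) ≡⟨ cong (_+ 2 * (2 * q * r)) (odd-inverse-balance t (r * 2) p q inverse) ⟩
    2 * (q * t) + 2 * (2 * q * r)         ≡⟨ lemma′ q t r ⟩
    2 * (q * (t + r * 2))                 ∎)) (sym (⌊[a-1]*2q/2⌋≡q*[a-1] a q))
    where
    open ≡-Reasoning
    a = suc t + r * 2
    lemma : ∀ a p q r → 2 * (a * p + (1 + 2 * q) * r) ≡ 2 * (a * p) + r * 2 + 2 * (2 * q * r)
    lemma = solve-∀
    lemma′ : ∀ q t r → 2 * (q * t) + 2 * (2 * q * r) ≡ 2 * (q * (t + r * 2))
    lemma′ = solve-∀

  even-inverse-balance : ∀ j s p q → (suc (1 + 2 * j) + s) * (2 * p) ≡ 1 + (1 + 2 * q) * (1 + 2 * j) →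
    (suc (1 + 2 * j) + s) * (p + q) ≡ q * (1 + 2 * j + s) + (1 + 2 * q) * (1 + j)
  even-inverse-balance j s p q inverse = ℕP.*-cancelˡ-≡ _ _ 2 (begin
    2 * (a * (p + q))                         ≡⟨ lemma j s p q ⟩
    a * (2 * p) + 2 * q * a                   ≡⟨ cong (_+ 2 * q * a) inverse ⟩
    1 + (1 + 2 * q) * (1 + 2 * j) + 2 * q * a ≡⟨ lemma′ j s q ⟩
    2 * (q * (1 + 2 * j + s) + (1 + 2 * q) * (1 + j)) ∎)
    where
    open ≡-Reasoning
    a = 2 + 2 * j + s
    lemma : ∀ j s p q → 2 * ((2 + 2 * j + s) * (p + q)) ≡ (2 + 2 * j + s) * (2 * p) + 2 * q * (2 + 2 * j + s)
    lemma = solve-∀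
    lemma′ : ∀ j s q → 1 + (1 + 2 * q) * (1 + 2 * j) + 2 * q * (2 + 2 * j + s)
                     ≡ 2 * (q * (1 + 2 * j + s) + (1 + 2 * q) * (1 + j))
    lemma′ = solve-∀

  a*x+b*[1+z]≡a*n⇒b≤n : ∀ {a b x z n} → Coprime b a → a * x + b * suc z ≡ a * n → b ≤ n
  a*x+b*[1+z]≡a*n⇒b≤n {b = zero} _ _ = z≤n
  a*x+b*[1+z]≡a*n⇒b≤n {zero} {suc _} _ ()
  a*x+b*[1+z]≡a*n⇒b≤n {a@(suc _)} {b@(suc _)} {x} {z} {n} coprime eq
    with ℕP.m≤n⇒∃[o]m+o≡n (ℕP.*-cancelˡ-< a x n (subst (a * x <_) eq (ℕP.m<m+n (a * x) (s≤s z≤n))))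
  ... | d , refl =
    ℕP.≤-trans (∣⇒≤ (coprime-divisor coprime (divides (suc z) a*[1+d]≡[1+z]*b))) (s≤s (ℕP.m≤n+m d x))
    where
    a*[1+d]≡[1+z]*b : a * suc d ≡ suc z * b
    a*[1+d]≡[1+z]*b = ℕP.+-cancelˡ-≡ (a * x) _ _ (begin
      a * x + a * suc d ≡⟨ ℕP.*-distribˡ-+ a x (suc d) ⟨
      a * (x + suc d)   ≡⟨ cong (a *_) (ℕP.+-suc x d) ⟩
      a * (suc x + d)   ≡⟨ eq ⟨
      a * x + b * suc z ≡⟨ cong (_+_ (a * x)) (ℕP.*-comm b (suc z)) ⟩
      a * x + suc z * b ∎)
      where open ≡-Reasoning

  -- Parity forces t = 1 + 2j, and then a (p + q) = N + b (1 + j) for the target N of (E1);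
  -- a solution a x + b y = N would give a x + b (y + 1 + j) = a (p + q), so b ≤ p + q < b.
  ¬usesE1-of-even-inverse : ∀ {a t} p q → a * (2 * p) ≡ 1 + (1 + 2 * q) * t → 2 * p < 1 + 2 * q →
    ¬ UsesE1 a (1 + 2 * q)
  ¬usesE1-of-even-inverse {a} {t} p q inverse 2p<b with parity t
  ... | even j = λ _ →
    2∤1+2*i (b * j) (subst (2 ∣_) (trans inverse (cong suc (lemma b j))) (∣n⇒∣m*n a (2∣2*i p)))
    where
    b = 1 + 2 * q
    lemma : ∀ b j → b * (2 * j) ≡ 2 * (b * j)
    lemma = solve-∀
  ... | odd j with ℕP.m≤n⇒∃[o]m+o≡n {n = a} (inverse⇒quotient< inverse 2p<b)
  ... | s , refl = λ (x , y , solution) → contradiction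
    (a*x+b*[1+z]≡a*n⇒b≤n {a} {b} {x} (Coprime.sym (inverse⇒coprime {a} {b} {2 * p} inverse)) (shifted x y solution))
    (ℕP.<⇒≱ p+q<b)
    where
    b = 1 + 2 * q
    double : ∀ q → 2 * q ≡ q + q
    double = solve-∀
    p+q<b : p + q < b
    p+q<b = ℕP.≤-<-trans (ℕP.+-monoˡ-≤ q (ℕP.*-cancelˡ-≤ 2 (ℕP.≤-pred 2p<b)))
                         (subst (_< b) (double q) (ℕP.n<1+n (2 * q)))
    shifted : ∀ x y → a * x + b * y ≡ ⌊ (a ∸ 1) * (b ∸ 1) /2⌋ → a * x + b * suc (y + j) ≡ a * (p + q)
    shifted x y solution = begin
      a * x + b * suc (y + j)     ≡⟨ lemma a b x y j ⟩
      a * x + b * y + b * (1 + j) ≡⟨ cong (_+ b * (1 + j)) (trans solution (⌊[a-1]*2q/2⌋≡q*[a-1] a q)) ⟩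
      q * (a ∸ 1) + b * (1 + j)   ≡⟨ even-inverse-balance j s p q inverse ⟨
      a * (p + q)                 ∎
      where
      open ≡-Reasoning
      lemma : ∀ a b x y j → a * x + b * suc (y + j) ≡ a * x + b * y + b * (1 + j)
      lemma = solve-∀

  Γ-of-inverse : ∀ {a b α t} → a * α ≡ 1 + b * t → α < b → ∃ (λ q → b ≡ 1 + 2 * q) →
    ΓIs a b (1 + (1 + α) % 2)
  Γ-of-inverse {a} {b} {α} inverse α<b (q , refl) with parity α
  ... | odd p  = subst (ΓIs a b) (cong suc (sym ([2+2i]%2≡0 p)))
    (ΓIs-uses coprime (usesE1-of-odd-inverse {a} p q inverse (inverse⇒quotient< {a} {b} inverse α<b)))
    where coprime = inverse⇒coprime {a} {b} inverse
  ... | even p = subst (ΓIs a b) (cong suc (sym ([1+2i]%2≡1 p)))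
    (ΓIs-¬uses coprime (¬usesE1-of-even-inverse {a} p q inverse α<b))
    where coprime = inverse⇒coprime {a} {b} inverse

  Γ-of-inverse-swapped : ∀ {a b β t} → b * β ≡ 1 + a * t → β < a → ∃ (λ q → a ≡ 1 + 2 * q) →
    ΓIs a b (1 + (1 + β) % 2)
  Γ-of-inverse-swapped {a} {b} inverse β<a a-odd =
    ΓIs-swap (Coprime.sym (inverse⇒coprime {b} {a} inverse)) (Γ-of-inverse {b} {a} inverse β<a a-odd)

-- Congruences of integers

module _ where
  open import Data.Integer using (_+_; _*_; _^_)
  open import Data.Integer.Tactic.RingSolver using (solve-∀)

  infix 4 _≡_mod_
  record _≡_mod_ (a b m : ℤ) : Set where
    constructor congruent
    field
      quotient : ℤ
      equation : a ≡ b + m * quotient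

  module _ {m : ℤ} where

    ≡-mod-reflexive : ∀ {a b} → a ≡ b → a ≡ b mod m
    ≡-mod-reflexive {a} refl = congruent (+ 0) (lemma a m)
      where
      lemma : ∀ a m → a ≡ a + m * + 0
      lemma = solve-∀

    ≡-mod-sym : ∀ {a b} → a ≡ b mod m → b ≡ a mod m
    ≡-mod-sym {b = b} (congruent q refl) = congruent (- q) (lemma b m q)
      where
      lemma : ∀ b m q → b ≡ b + m * q + m * - q
      lemma = solve-∀

    ≡-mod-trans : ∀ {a b c} → a ≡ b mod m → b ≡ c mod m → a ≡ c mod m
    ≡-mod-trans {c = c} (congruent q refl) (congruent r refl) = congruent (r + q) (lemma c m q r)
      where
      lemma : ∀ c m q r → c + m * r + m * q ≡ c + m * (r + q)
      lemma = solve-∀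

    ≡-mod-+ : ∀ {a b c d} → a ≡ b mod m → c ≡ d mod m → a + c ≡ b + d mod m
    ≡-mod-+ {b = b} {d = d} (congruent q refl) (congruent r refl) = congruent (q + r) (lemma b d m q r)
      where
      lemma : ∀ b d m q r → b + m * q + (d + m * r) ≡ b + d + m * (q + r)
      lemma = solve-∀

    ≡-mod-* : ∀ {a b c d} → a ≡ b mod m → c ≡ d mod m → a * c ≡ b * d mod m
    ≡-mod-* {b = b} {d = d} (congruent q refl) (congruent r refl) =
      congruent (b * r + q * d + m * q * r) (lemma b d m q r)
      where
      lemma : ∀ b d m q r → (b + m * q) * (d + m * r) ≡ b * d + m * (b * r + q * d + m * q * r)
      lemma = solve-∀

    ≡-mod-+ˡ : ∀ c {a b} → a ≡ b mod m → c + a ≡ c + b mod m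
    ≡-mod-+ˡ c = ≡-mod-+ (≡-mod-reflexive {c} refl)

    ≡-mod-*ˡ : ∀ c {a b} → a ≡ b mod m → c * a ≡ c * b mod m
    ≡-mod-*ˡ c = ≡-mod-* (≡-mod-reflexive {c} refl)

    ≡-mod-neg : ∀ {a b} → a ≡ b mod m → - a ≡ - b mod m
    ≡-mod-neg {b = b} (congruent q refl) = congruent (- q) (lemma b m q)
      where
      lemma : ∀ b m q → - (b + m * q) ≡ - b + m * - q
      lemma = solve-∀

    ≡-mod-^ : ∀ {a b} k → a ≡ b mod m → a ^ k ≡ b ^ k mod m
    ≡-mod-^ zero    a≡b = ≡-mod-reflexive refl
    ≡-mod-^ (suc k) a≡b = ≡-mod-* a≡b (≡-mod-^ k a≡b)

    ≡-mod-isEquivalence : IsEquivalence (λ a b → a ≡ b mod m)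
    ≡-mod-isEquivalence = record
      { refl = ≡-mod-reflexive refl ; sym = ≡-mod-sym ; trans = ≡-mod-trans }

  ≡-mod-setoid : ℤ → Setoid _ _
  ≡-mod-setoid m = record { isEquivalence = ≡-mod-isEquivalence {m} }

  ≡-mod-neg-modulus : ∀ {a b m} → a ≡ b mod - m → a ≡ b mod m
  ≡-mod-neg-modulus {b = b} {m} (congruent q refl) = congruent (- q) (lemma b m q)
    where
    lemma : ∀ b m q → b + - m * q ≡ b + m * - q
    lemma = solve-∀

module _ where
  open import Data.Nat using (_+_; _*_; _^_)
  open import Data.Integer.Tactic.RingSolver using (solve-∀)

  alternate : ℕ → ℤ → ℤ
  alternate zero    z = z
  alternate (suc L) z = ℤ.- alternate L z

  alternate-+ : ∀ L a b → alternate L (a ℤ.+ b) ≡ alternate L a ℤ.+ alternate L b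
  alternate-+ zero    a b = refl
  alternate-+ (suc L) a b = trans (cong ℤ.-_ (alternate-+ L a b)) (ℤP.neg-distrib-+ (alternate L a) (alternate L b))

  alternate-* : ∀ L a b → alternate L (a ℤ.* b) ≡ a ℤ.* alternate L b
  alternate-* zero    a b = refl
  alternate-* (suc L) a b = trans (cong ℤ.-_ (alternate-* L a b)) (ℤP.neg-distribʳ-* a (alternate L b))

  alternate-swap : ∀ L a b → alternate L a ℤ.* b ≡ a ℤ.* alternate L b
  alternate-swap zero    a b = refl
  alternate-swap (suc L) a b = trans (sym (ℤP.neg-distribˡ-* (alternate L a) b))
                                     (trans (cong ℤ.-_ (alternate-swap L a b)) (ℤP.neg-distribʳ-* a (alternate L b)))

  alternate-sign : ∀ L z → alternate L z ≡ z ⊎ alternate L z ≡ ℤ.- z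
  alternate-sign zero    z = inj₁ refl
  alternate-sign (suc L) z with alternate-sign L z
  ... | inj₁ eq = inj₂ (cong ℤ.-_ eq)
  ... | inj₂ eq = inj₁ (trans (cong ℤ.-_ eq) (ℤP.neg-involutive z))

  alternate-2* : ∀ j z → alternate (2 * j) z ≡ z
  alternate-2* zero    z = refl
  alternate-2* (suc j) z = trans (cong (λ L → alternate L z) (ℕP.*-suc 2 j))
                                 (trans (ℤP.neg-involutive (alternate (2 * j) z)) (alternate-2* j z))

  neg-^ : ∀ x k → (ℤ.- x) ℤ.^ k ≡ alternate k (x ℤ.^ k)
  neg-^ x zero    = refl
  neg-^ x (suc k) = trans (cong ((ℤ.- x) ℤ.*_) (neg-^ x k))
                          (trans (sym (ℤP.neg-distribˡ-* x _)) (cong ℤ.-_ (sym (alternate-* k x (x ℤ.^ k)))))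

  pos-^ : ∀ n k → (+ n) ℤ.^ k ≡ + (n ^ k)
  pos-^ n zero    = refl
  pos-^ n (suc k) = trans (cong (ℤ._*_ (+ n)) (pos-^ n k)) (sym (ℤP.pos-* n (n ^ k)))

  pos-∸ : ∀ {m n} → n ≤ m → + m ℤ.- + n ≡ + (m ∸ n)
  pos-∸ {m} {n} n≤m = trans (ℤP.m-n≡m⊖n m n) (ℤP.⊖-≥ n≤m)

  ≡-mod-alternate : ∀ {a b m} L → a ≡ b mod alternate L m → a ≡ b mod m
  ≡-mod-alternate {m = m} L with alternate L m | alternate-sign L m
  ... | _ | inj₁ refl = id
  ... | _ | inj₂ refl = ≡-mod-neg-modulus

  ≡1-mod⇒ℕ : ∀ {A B} → 1 ≤ A → + A ≡ + 1 mod + B → ∃ λ t → A ≡ 1 + B * t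
  ≡1-mod⇒ℕ {A} {B} _ (congruent (+ t) eq) =
    t , ℤP.+-injective (trans eq (cong (ℤ._+_ (+ 1)) (sym (ℤP.pos-* B t))))
  ≡1-mod⇒ℕ {suc A} {B} _ (congruent -[1+ t ] eq) =
    0 , cong suc (trans (ℕP.m+n≡0⇒m≡0 A (ℕP.suc-injective (ℤP.+-injective sum≡1))) (sym (ℕP.*-zeroʳ B)))
    where
    lemma : ∀ b s → + 1 ℤ.+ b ℤ.* ℤ.- s ℤ.+ b ℤ.* s ≡ + 1
    lemma = solve-∀
    sum≡1 : + (suc A + B * suc t) ≡ + 1
    sum≡1 = trans (cong (ℤ._+_ (+ suc A)) (ℤP.pos-* B (suc t)))
                  (trans (cong (ℤ._+ + B ℤ.* + suc t) eq) (lemma (+ B) (+ suc t)))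

  %≡-of-ℕ-quotient : ∀ {x y} d .{{_ : ℕ.NonZero d}} q → + x ≡ + y ℤ.+ + d ℤ.* + q → x % d ≡ y % d
  %≡-of-ℕ-quotient {x} {y} d q eq =
    trans (cong (_% d) (ℤP.+-injective (trans eq (cong (ℤ._+_ (+ y)) (sym (ℤP.pos-* d q))))))
          (trans (cong (λ z → (y + z) % d) (ℕP.*-comm d q)) ([m+kn]%n≡m%n y q d))

  ≡-mod⇒%≡ : ∀ {x y} d .{{_ : ℕ.NonZero d}} → + x ≡ + y mod + d → x % d ≡ y % d
  ≡-mod⇒%≡ d (congruent (+ q) eq) = %≡-of-ℕ-quotient d q eq
  ≡-mod⇒%≡ {x} {y} d (congruent -[1+ q ] eq) =
    sym (%≡-of-ℕ-quotient d (suc q) (trans (lemma (+ y) (+ d) (+ suc q)) (cong (ℤ._+ + d ℤ.* + suc q) (sym eq))))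
    where
    lemma : ∀ y d s → y ≡ y ℤ.+ d ℤ.* ℤ.- s ℤ.+ d ℤ.* s
    lemma = solve-∀

  ≡-mod-2-ℕ : ∀ {x y} q → x ≡ y + 2 * q → + x ≡ + y mod + 2
  ≡-mod-2-ℕ {y = y} q refl = congruent (+ q) (cong (ℤ._+_ (+ y)) (ℤP.pos-* 2 q))

  odd≡1-mod-2 : ∀ i → + (1 + 2 * i) ≡ + 1 mod + 2
  odd≡1-mod-2 i = ≡-mod-2-ℕ i refl

  -odd≡1-mod-2 : ∀ i → ℤ.- + (1 + 2 * i) ≡ + 1 mod + 2
  -odd≡1-mod-2 i = ≡-mod-trans (≡-mod-neg (odd≡1-mod-2 i)) (congruent (ℤ.- + 1) refl)

  odd^≡1-mod-2 : ∀ i k → + ((1 + 2 * i) ^ k) ≡ + 1 mod + 2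
  odd^≡1-mod-2 i k =
    subst₂ (λ a b → a ≡ b mod + 2) (pos-^ (1 + 2 * i) k) (ℤP.^-zeroˡ k) (≡-mod-^ k (odd≡1-mod-2 i))

-- Evaluation of polynomials

module _ where
  open import Data.Integer using (_+_; _-_; _*_; _^_)
  open import Data.Integer.Tactic.RingSolver using (solve-∀)

  eval-≡-mod : ∀ p {x y m} → x ≡ y mod m → eval p x ≡ eval p y mod m
  eval-≡-mod []       _   = ≡-mod-reflexive refl
  eval-≡-mod (c ∷ cs) x≡y = ≡-mod-+ (≡-mod-reflexive {a = + c} refl) (≡-mod-* x≡y (eval-≡-mod cs x≡y))

  eval-⊕ : ∀ p q x → eval (p ⊕ q) x ≡ eval p x + eval q x
  eval-⊕ []       q        x = sym (ℤP.+-identityˡ _)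
  eval-⊕ (c ∷ cs) []       x = sym (ℤP.+-identityʳ _)
  eval-⊕ (c ∷ cs) (d ∷ ds) x = begin
    + c + + d + x * eval (cs ⊕ ds) x          ≡⟨ cong (λ e → + c + + d + x * e) (eval-⊕ cs ds x) ⟩
    + c + + d + x * (eval cs x + eval ds x)   ≡⟨ lemma (+ c) (+ d) x (eval cs x) (eval ds x) ⟩
    + c + x * eval cs x + (+ d + x * eval ds x) ∎
    where
    open ≡-Reasoning
    lemma : ∀ c d x u v → c + d + x * (u + v) ≡ c + x * u + (d + x * v)
    lemma = solve-∀

  eval-scale : ∀ c q x → eval (scale c q) x ≡ + c * eval q x
  eval-scale c []       x = sym (ℤP.*-zeroʳ (+ c))
  eval-scale c (d ∷ ds) x = begin
    + (c ℕ.* d) + x * eval (scale c ds) x ≡⟨ cong₂ (λ u v → u + x * v) (ℤP.pos-* c d) (eval-scale c ds x) ⟩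
    + c * + d + x * (+ c * eval ds x)     ≡⟨ lemma (+ c) (+ d) x (eval ds x) ⟩
    + c * (+ d + x * eval ds x)           ∎
    where
    open ≡-Reasoning
    lemma : ∀ c d x u → c * d + x * (c * u) ≡ c * (d + x * u)
    lemma = solve-∀

  eval-⊗ : ∀ p q x → eval (p ⊗ q) x ≡ eval p x * eval q x
  eval-⊗ []       q x = refl
  eval-⊗ (c ∷ cs) q x = begin
    eval (scale c q ⊕ (0 ∷ (cs ⊗ q))) x
      ≡⟨ eval-⊕ (scale c q) (0 ∷ (cs ⊗ q)) x ⟩
    eval (scale c q) x + (+ 0 + x * eval (cs ⊗ q) x)
      ≡⟨ cong₂ (λ u v → u + (+ 0 + x * v)) (eval-scale c q x) (eval-⊗ cs q x) ⟩
    + c * eval q x + (+ 0 + x * (eval cs x * eval q x))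
      ≡⟨ lemma (+ c) x (eval cs x) (eval q x) ⟩
    (+ c + x * eval cs x) * eval q x
      ∎
    where
    open ≡-Reasoning
    lemma : ∀ c x u v → c * v + (+ 0 + x * (u * v)) ≡ (c + x * u) * v
    lemma = solve-∀

  eval-^ₚ : ∀ p k x → eval (p ^ₚ k) x ≡ eval p x ^ k
  eval-^ₚ p zero    x = cong (_+_ (+ 1)) (ℤP.*-zeroʳ x)
  eval-^ₚ p (suc k) x = trans (eval-⊗ p (p ^ₚ k) x) (cong (eval p x *_) (eval-^ₚ p k x))

  eval-take-drop : ∀ k p x → eval p x ≡ eval (take k p) x + x ^ k * eval (drop k p) x
  eval-take-drop zero    p        x = sym (trans (ℤP.+-identityˡ _) (ℤP.*-identityˡ _))
  eval-take-drop (suc k) []       x = sym (trans (ℤP.+-identityˡ _) (ℤP.*-zeroʳ (x ^ suc k)))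
  eval-take-drop (suc k) (c ∷ cs) x = begin
    + c + x * eval cs x
      ≡⟨ cong (λ e → + c + x * e) (eval-take-drop k cs x) ⟩
    + c + x * (eval (take k cs) x + x ^ k * eval (drop k cs) x)
      ≡⟨ lemma (+ c) x (eval (take k cs) x) (x ^ k) (eval (drop k cs) x) ⟩
    + c + x * eval (take k cs) x + x * x ^ k * eval (drop k cs) x
      ∎
    where
    open ≡-Reasoning
    lemma : ∀ c x u y v → c + x * (u + y * v) ≡ c + x * u + x * y * v
    lemma = solve-∀

  eval-geomSum : ∀ k x → eval (geomSum k) x * (+ 1 - x) ≡ + 1 - x ^ k
  eval-geomSum zero    x = refl
  eval-geomSum (suc k) x = begin
    (+ 1 + x * eval (geomSum k) x) * (+ 1 - x)     ≡⟨ lemma x (eval (geomSum k) x) ⟩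
    + 1 - x + x * (eval (geomSum k) x * (+ 1 - x)) ≡⟨ cong (λ e → + 1 - x + x * e) (eval-geomSum k x) ⟩
    + 1 - x + x * (+ 1 - x ^ k)                     ≡⟨ lemma′ x (x ^ k) ⟩
    + 1 - x * x ^ k                                 ∎
    where
    open ≡-Reasoning
    lemma : ∀ x e → (+ 1 + x * e) * (+ 1 - x) ≡ + 1 - x + x * (e * (+ 1 - x))
    lemma = solve-∀
    lemma′ : ∀ x y → + 1 - x + x * (+ 1 - y) ≡ + 1 - x * y
    lemma′ = solve-∀

  ^-distribʳ-* : ∀ x y k → (x * y) ^ k ≡ x ^ k * y ^ k
  ^-distribʳ-* x y zero    = refl
  ^-distribʳ-* x y (suc k) = trans (cong ((x * y) *_) (^-distribʳ-* x y k)) (lemma x y (x ^ k) (y ^ k))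
    where
    lemma : ∀ x y u v → x * y * (u * v) ≡ x * u * (y * v)
    lemma = solve-∀

  [1-x]^k*g≡1 : ∀ k x → (+ 1 - x) ^ k * g k x ≡ + 1 mod x ^ k
  [1-x]^k*g≡1 k x = begin
    (+ 1 - x) ^ k * g k x         ≈⟨ ≡-mod-*ˡ ((+ 1 - x) ^ k) g≡P ⟩
    (+ 1 - x) ^ k * eval P x      ≡⟨ cong ((+ 1 - x) ^ k *_) (eval-^ₚ (geomSum k) k x) ⟩
    (+ 1 - x) ^ k * G ^ k         ≡⟨ trans (ℤP.*-comm _ (G ^ k)) (sym (^-distribʳ-* G (+ 1 - x) k)) ⟩
    (G * (+ 1 - x)) ^ k           ≡⟨ cong (_^ k) (eval-geomSum k x) ⟩
    (+ 1 - x ^ k) ^ k             ≈⟨ ≡-mod-^ k (congruent (- + 1) (lemma (x ^ k))) ⟩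
    (+ 1) ^ k                     ≡⟨ ℤP.^-zeroˡ k ⟩
    + 1                           ∎
    where
    open import Relation.Binary.Reasoning.Setoid (≡-mod-setoid (x ^ k))
    P = geomSum k ^ₚ k
    G = eval (geomSum k) x
    g≡P : g k x ≡ eval P x mod x ^ k
    g≡P = ≡-mod-sym (congruent _ (eval-take-drop k P x))
    lemma : ∀ y → + 1 - y ≡ + 1 + y * - + 1
    lemma = solve-∀

-- The coefficients of g

module _ where
  open import Data.Nat using (_+_; _*_; _^_)
  open import Data.List using (length)
  open import Data.List.Properties using (length-take; length-replicate)
  open import Data.List.Relation.Unary.All as All using (All; []; _∷_)
  open import Data.List.Relation.Unary.All.Properties using (take⁺; replicate⁺)
  open import Data.Integer.Tactic.RingSolver using (solve-∀)

  Positive : Poly → Set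
  Positive = All (1 ≤_)

  ⊕-positive : ∀ {p q} → Positive p → Positive q → Positive (p ⊕ q)
  ⊕-positive []         q≥1        = q≥1
  ⊕-positive (c≥1 ∷ p≥1) []        = c≥1 ∷ p≥1
  ⊕-positive (c≥1 ∷ p≥1) (d≥1 ∷ q≥1) = ℕP.≤-trans c≥1 (ℕP.m≤m+n _ _) ∷ ⊕-positive p≥1 q≥1

  scale-positive : ∀ {c q} → 1 ≤ c → Positive q → Positive (scale c q)
  scale-positive c≥1 []          = []
  scale-positive c≥1 (d≥1 ∷ q≥1) = ℕP.*-mono-≤ c≥1 d≥1 ∷ scale-positive c≥1 q≥1

  ⊗-positive : ∀ {p q} → Positive p → Positive q → 1 ≤ length q → Positive (p ⊗ q)
  ⊗-positive []                  _   _  = []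
  ⊗-positive {q = []}    (_ ∷ _) _   ()
  ⊗-positive {q = _ ∷ _} (c≥1 ∷ p≥1) (d≥1 ∷ q≥1) _ =
    ℕP.≤-trans (ℕP.*-mono-≤ c≥1 d≥1) (ℕP.m≤m+n _ 0) ∷
    ⊕-positive (scale-positive c≥1 q≥1) (⊗-positive p≥1 (d≥1 ∷ q≥1) (s≤s z≤n))

  length-⊕ʳ : ∀ p q → length q ≤ length (p ⊕ q)
  length-⊕ʳ []       q        = ℕP.≤-refl
  length-⊕ʳ (c ∷ p)  []       = z≤n
  length-⊕ʳ (c ∷ p)  (d ∷ q)  = s≤s (length-⊕ʳ p q)

  length-⊗ : ∀ p q → 1 ≤ length q → length p ≤ length (p ⊗ q)
  length-⊗ []      q       _  = z≤n
  length-⊗ (c ∷ p) []      ()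
  length-⊗ (c ∷ p) (d ∷ q) _  =
    s≤s (ℕP.≤-trans (length-⊗ p (d ∷ q) (s≤s z≤n)) (length-⊕ʳ (scale c q) (p ⊗ (d ∷ q))))

  ^ₚ-positive : ∀ {p} j → Positive p → 1 ≤ length p → Positive (p ^ₚ j) × 1 ≤ length (p ^ₚ j)
  ^ₚ-positive zero    _   _          = s≤s z≤n ∷ [] , s≤s z≤n
  ^ₚ-positive {p} (suc j) p≥1 length≥1 with ^ₚ-positive j p≥1 length≥1
  ... | pʲ≥1 , length-pʲ≥1 =
    ⊗-positive p≥1 pʲ≥1 length-pʲ≥1 , ℕP.≤-trans length≥1 (length-⊗ p (p ^ₚ j) length-pʲ≥1)

  geomSum-positive : ∀ k → Positive (geomSum k)
  geomSum-positive k = replicate⁺ k (s≤s z≤n)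

  gPoly-positive : ∀ k → Positive (gPoly k)
  gPoly-positive zero    = []
  gPoly-positive (suc L) = take⁺ (suc L) (proj₁ (^ₚ-positive (suc L) (geomSum-positive (suc L)) (s≤s z≤n)))

  length-gPoly : ∀ k → length (gPoly k) ≡ k
  length-gPoly zero    = refl
  length-gPoly (suc L) = trans (length-take (suc L) (G ^ₚ suc L)) (ℕP.m≤n⇒m⊓n≡m k≤length)
    where
    G = geomSum (suc L)
    k≤length : suc L ≤ length (G ^ₚ suc L)
    k≤length = subst (_≤ length (G ^ₚ suc L)) (length-replicate (suc L))
      (length-⊗ G (G ^ₚ L) (proj₂ (^ₚ-positive L (geomSum-positive (suc L)) (s≤s z≤n))))

  evalℕ : Poly → ℕ → ℕ
  evalℕ []       n = 0
  evalℕ (c ∷ cs) n = c + n * evalℕ cs n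

  eval-+ : ∀ p n → eval p (+ n) ≡ + evalℕ p n
  eval-+ []       n = refl
  eval-+ (c ∷ cs) n =
    trans (cong (λ e → + c ℤ.+ + n ℤ.* e) (eval-+ cs n)) (cong (ℤ._+_ (+ c)) (sym (ℤP.pos-* n (evalℕ cs n))))

  g≡g[1]-mod-2 : ∀ k {x} → x ≡ + 1 mod + 2 → g k x ≡ + evalℕ (gPoly k) 1 mod + 2
  g≡g[1]-mod-2 k x≡1 = subst (λ z → g k _ ≡ z mod + 2) (eval-+ (gPoly k) 1) (eval-≡-mod (gPoly k) x≡1)

  evalℕ<^length : ∀ {n} p → All (_< n) p → evalℕ p n < n ^ length p
  evalℕ<^length     []       []            = s≤s z≤n
  evalℕ<^length {n} (c ∷ cs) (c<n ∷ cs<n) = begin-strict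
    c + n * evalℕ cs n <⟨ ℕP.+-monoˡ-< (n * evalℕ cs n) c<n ⟩
    n + n * evalℕ cs n ≡⟨ ℕP.*-suc n (evalℕ cs n) ⟨
    n * suc (evalℕ cs n) ≤⟨ ℕP.*-monoʳ-≤ n (evalℕ<^length cs cs<n) ⟩
    n * n ^ length cs  ∎
    where open ℕP.≤-Reasoning

  coefficients≤evalℕ-1 : ∀ p → All (_≤ evalℕ p 1) p
  coefficients≤evalℕ-1 []       = []
  coefficients≤evalℕ-1 (c ∷ cs) =
    ℕP.m≤m+n c _ ∷ All.map (λ d≤ → ℕP.≤-trans d≤ tail≤) (coefficients≤evalℕ-1 cs)
    where
    tail≤ : evalℕ cs 1 ≤ c + 1 * evalℕ cs 1
    tail≤ = ℕP.≤-trans (ℕP.≤-reflexive (sym (ℕP.*-identityˡ _))) (ℕP.m≤n+m _ c)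

  coefficients<evalℕ-1 : ∀ {n} p → evalℕ p 1 < n → All (_< n) p
  coefficients<evalℕ-1 p bound = All.map (λ c≤ → ℕP.≤-<-trans c≤ bound) (coefficients≤evalℕ-1 p)

  alternate-horner : ∀ L c x e →
    alternate (suc L) (+ c ℤ.+ ℤ.- x ℤ.* e) ≡ x ℤ.* alternate L e ℤ.- alternate L (+ c)
  alternate-horner L c x e =
    trans (cong ℤ.-_ (trans (alternate-+ L (+ c) _) (cong (ℤ._+_ (alternate L (+ c))) (alternate-* L (ℤ.- x) e))))
          (lemma (alternate L (+ c)) x (alternate L e))
    where
    lemma : ∀ a x b → ℤ.- (a ℤ.+ ℤ.- x ℤ.* b) ≡ x ℤ.* b ℤ.- a
    lemma = solve-∀

  alternate-eval-neg : ∀ {n} c cs → Positive (c ∷ cs) → All (_< n) (c ∷ cs) →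
    ∃ λ m → alternate (length cs) (eval (c ∷ cs) (ℤ.- + n)) ≡ + m × 1 ≤ m × m ≤ evalℕ (c ∷ cs) n
  alternate-eval-neg {n} c [] (c≥1 ∷ []) _ =
    c , trans (cong (ℤ._+_ (+ c)) (ℤP.*-zeroʳ (ℤ.- + n))) (ℤP.+-identityʳ (+ c)) , c≥1 , ℕP.m≤m+n c _
  alternate-eval-neg {n} c (d ∷ ds) (c≥1 ∷ ds≥1) (c<n ∷ ds<n)
    with alternate-eval-neg d ds ds≥1 ds<n | alternate-sign (length ds) (+ c)
  ... | m , eq , m≥1 , m≤ | inj₁ alt-c =
    n * m ∸ c , trans step (pos-∸ (ℕP.<⇒≤ c<nm)) , ℕP.m<n⇒0<n∸m c<nm ,
    ℕP.≤-trans (ℕP.m∸n≤m (n * m) c) (ℕP.≤-trans (ℕP.*-monoʳ-≤ n m≤) (ℕP.m≤n+m _ c))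
    where
    c<nm : c < n * m
    c<nm = ℕP.<-≤-trans c<n (ℕP.m≤m*n n m ⦃ ℕ.>-nonZero m≥1 ⦄)
    step : alternate (suc (length ds)) (eval (c ∷ d ∷ ds) (ℤ.- + n)) ≡ + (n * m) ℤ.- + c
    step = trans (alternate-horner (length ds) c (+ n) _)
                 (trans (cong₂ (λ e a → + n ℤ.* e ℤ.- a) eq alt-c) (cong (ℤ._- + c) (sym (ℤP.pos-* n m))))
  ... | m , eq , m≥1 , m≤ | inj₂ alt-c = c + n * m , step , ℕP.≤-trans c≥1 (ℕP.m≤m+n c _) ,
    ℕP.+-monoʳ-≤ c (ℕP.*-monoʳ-≤ n m≤)
    where
    step : alternate (suc (length ds)) (eval (c ∷ d ∷ ds) (ℤ.- + n)) ≡ + (c + n * m)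
    step = begin
      alternate (suc (length ds)) (eval (c ∷ d ∷ ds) (ℤ.- + n)) ≡⟨ alternate-horner (length ds) c (+ n) _ ⟩
      + n ℤ.* _ ℤ.- alternate (length ds) (+ c)   ≡⟨ cong₂ (λ e a → + n ℤ.* e ℤ.- a) eq alt-c ⟩
      + n ℤ.* + m ℤ.- ℤ.- + c                     ≡⟨ cong (ℤ._+_ (+ n ℤ.* + m)) (ℤP.neg-involutive (+ c)) ⟩
      + n ℤ.* + m ℤ.+ + c                         ≡⟨ cong (ℤ._+ + c) (sym (ℤP.pos-* n m)) ⟩
      + (n * m + c)                               ≡⟨ cong +_ (ℕP.+-comm (n * m) c) ⟩
      + (c + n * m)                               ∎
      where open ≡-Reasoning

  alternating-bounds : ∀ {n} c cs → Positive (c ∷ cs) → evalℕ (c ∷ cs) 1 < n → ∃₂ λ P m →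
    eval (c ∷ cs) (+ n) ≡ + P × alternate (length cs) (eval (c ∷ cs) (ℤ.- + n)) ≡ + m ×
    1 ≤ P × P < n ^ suc (length cs) × 1 ≤ m × m < n ^ suc (length cs)
  alternating-bounds {n} c cs c∷cs≥1@(c≥1 ∷ _) bound
    with alternate-eval-neg c cs c∷cs≥1 (coefficients<evalℕ-1 (c ∷ cs) bound)
  ... | m , alternate≡m , m≥1 , m≤P =
    P , m , eval-+ (c ∷ cs) n , alternate≡m , ℕP.≤-trans c≥1 (ℕP.m≤m+n c _) , P<nᵏ ,
    m≥1 , ℕP.≤-<-trans m≤P P<nᵏ
    where
    P = evalℕ (c ∷ cs) n
    P<nᵏ : P < n ^ suc (length cs)
    P<nᵏ = evalℕ<^length (c ∷ cs) (coefficients<evalℕ-1 (c ∷ cs) bound)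

  g-bounds : ∀ L n → evalℕ (gPoly (suc L)) 1 < n → ∃₂ λ P m →
    eval (gPoly (suc L)) (+ n) ≡ + P × alternate L (eval (gPoly (suc L)) (ℤ.- + n)) ≡ + m ×
    1 ≤ P × P < n ^ suc L × 1 ≤ m × m < n ^ suc L
  g-bounds L n bound with gPoly (suc L) | gPoly-positive (suc L) | length-gPoly (suc L)
  ... | c ∷ cs | c∷cs≥1 | refl = alternating-bounds c cs c∷cs≥1 bound

module _ where
  open import Data.Nat using (_+_; _*_)

  infix 4 0<_<_
  0<_<_ : ℤ → ℤ → Set
  0< z < N = + 0 ℤ.< z × z ℤ.< N

  0<+<+ : ∀ {w u} → 1 ≤ w → w < u → 0< + w < + u
  0<+<+ w≥1 w<u = ℤ.+<+ w≥1 , ℤ.+<+ w<u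

  0<+-+<+ : ∀ {w u} → 1 ≤ w → w < u → 0< + u ℤ.- + w < + u
  0<+-+<+ {w} {u} w≥1 w<u rewrite pos-∸ (ℕP.<⇒≤ w<u) =
    ℤ.+<+ (ℕP.m<n⇒0<n∸m w<u) , ℤ.+<+ (ℕP.∸-monoʳ-< w≥1 (ℕP.<⇒≤ w<u))

  0<-<-⇒ℕ : ∀ {z N} → 0< z < + N → ∃ λ w → z ≡ + w × 1 ≤ w × w < N
  0<-<-⇒ℕ {+ w} (ℤ.+<+ w≥1 , ℤ.+<+ w<N) = w , refl , w≥1 , w<N

  CondAt-eventually : ∀ k n → 1 ≤ k → evalℕ (gPoly k) 1 < n → CondAt k n
  CondAt-eventually (suc L) n _ bound with g-bounds L n bound | parity L
  ... | P , m , g[n]≡P , alternate≡m , P≥1 , P<nᵏ , m≥1 , m<nᵏ | even j =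
    (λ _ → k-odd) , (λ 2∣k → contradiction 2∣k (2∤1+2*i j))
    where
    k = 1 + 2 * j
    k-odd : 0< (+ n) ℤ.^ k ℤ.- g k (+ n) < (+ n) ℤ.^ k × 0< g k (ℤ.- + n) < (+ n) ℤ.^ k
    k-odd rewrite pos-^ n k | g[n]≡P | trans (sym (alternate-2* j _)) alternate≡m =
      0<+-+<+ P≥1 P<nᵏ , 0<+<+ m≥1 m<nᵏ
  ... | P , m , g[n]≡P , alternate≡m , P≥1 , P<nᵏ , m≥1 , m<nᵏ | odd j =
    (λ 2∤k → contradiction (subst (2 ∣_) (ℕP.*-suc 2 j) (2∣2*i (suc j))) 2∤k) , (λ _ → k-even)
    where
    k = 2 + 2 * j
    g[-n]≡-m : g k (ℤ.- + n) ≡ ℤ.- + m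
    g[-n]≡-m = trans (sym (alternate-2* j _)) (trans (sym (ℤP.neg-involutive _)) (cong ℤ.-_ alternate≡m))
    k-even : 0< (+ n) ℤ.^ k ℤ.+ g k (ℤ.- + n) < (+ n) ℤ.^ k × 0< g k (+ n) < (+ n) ℤ.^ k
    k-even rewrite pos-^ n k | g[n]≡P | g[-n]≡-m = 0<+-+<+ m≥1 m<nᵏ , 0<+<+ P≥1 P<nᵏ

  infix 4 0<_<?_
  0<_<?_ : ∀ z N → Dec (0< z < N)
  0< z <? N = + 0 ℤP.<? z ×-dec z ℤP.<? N

  CondAt? : ∀ k n → Dec (CondAt k n)
  CondAt? k n =
    (¬? (2 ∣? k) →-dec 0< N ℤ.- G <? N ×-dec 0< G⁻ <? N) ×-dec
    (2 ∣? k →-dec 0< N ℤ.+ G⁻ <? N ×-dec 0< G <? N)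
    where
    N = (+ n) ℤ.^ k
    G = g k (+ n)
    G⁻ = g k (ℤ.- + n)

  least-tail : ∀ {P : ℕ → Set} → Decidable P → ∀ d → (∀ n → suc d ≤ n → P n) →
    Σ ℕ λ M → 1 ≤ M × (∀ n → M ≤ n → P n) × (∀ m → 1 ≤ m → (∀ n → m ≤ n → P n) → M ≤ m)
  least-tail P? zero    tail = 1 , s≤s z≤n , tail , λ _ m≥1 _ → m≥1
  least-tail {P} P? (suc d) tail with P? (suc d)
  ... | yes P[1+d] = least-tail P? d tail′
    where
    tail′ : ∀ n → suc d ≤ n → P n
    tail′ n d<n with ℕP.m≤n⇒m<n∨m≡n d<n
    ... | inj₁ 1+d<n = tail n 1+d<n
    ... | inj₂ refl  = P[1+d]
  ... | no ¬P[1+d] =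
    suc (suc d) , s≤s z≤n , tail , λ m _ tailₘ → ℕP.≰⇒> (λ m≤1+d → ¬P[1+d] (tailₘ (suc d) m≤1+d))


-- The inverses at consecutive powers

module _ where
  open import Data.Nat using (_+_; _*_; _^_)
  import Data.Nat.Tactic.RingSolver as ℕ-Solver
  import Data.Integer.Tactic.RingSolver as ℤ-Solver

  inverse-of-succ-pow : ∀ k n → + (suc n ^ k) ℤ.* g k (ℤ.- + n) ≡ + 1 mod + (n ^ k)
  inverse-of-succ-pow k n = ≡-mod-alternate k (subst₂ (λ e m → e ℤ.* g k (ℤ.- + n) ≡ + 1 mod m) e≡ m≡ key)
    where
    key = [1-x]^k*g≡1 k (ℤ.- + n)
    e≡ : (+ 1 ℤ.- ℤ.- + n) ℤ.^ k ≡ + (suc n ^ k)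
    e≡ = trans (cong (λ x → (+ 1 ℤ.+ x) ℤ.^ k) (ℤP.neg-involutive (+ n))) (pos-^ (suc n) k)
    m≡ : (ℤ.- + n) ℤ.^ k ≡ alternate k (+ (n ^ k))
    m≡ = trans (neg-^ (+ n) k) (cong (alternate k) (pos-^ n k))

  inverse-of-pow : ∀ k n → + (n ^ k) ℤ.* alternate k (g k (+ suc n)) ≡ + 1 mod + (suc n ^ k)
  inverse-of-pow k n = subst₂ (λ e m → e ≡ + 1 mod m) e≡ (pos-^ (suc n) k) ([1-x]^k*g≡1 k (+ suc n))
    where
    lemma : ∀ x → + 1 ℤ.- (+ 1 ℤ.+ x) ≡ ℤ.- x
    lemma = ℤ-Solver.solve-∀
    e≡ : (+ 1 ℤ.- + suc n) ℤ.^ k ℤ.* g k (+ suc n) ≡ + (n ^ k) ℤ.* alternate k (g k (+ suc n))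
    e≡ = trans (cong (λ e → e ℤ.^ k ℤ.* g k (+ suc n)) (lemma (+ n)))
         (trans (cong (ℤ._* g k (+ suc n)) (trans (neg-^ (+ n) k) (cong (alternate k) (pos-^ n k))))
                (alternate-swap k _ _))

  phase : ℕ → ℕ
  phase k = 1 + k + evalℕ (gPoly k) 1

  InverseMod : ℕ → ℕ → ℕ → Set
  InverseMod e o r = ∃ λ u → u < o × (∃ λ t → e * u ≡ 1 + o * t) × (1 + u) % 2 ≡ r

  inverse-of-residue : ∀ {e o u c} → 1 ≤ e → 1 ≤ u → + e ℤ.* c ≡ + 1 mod + o → + u ≡ c mod + o →
    ∃ λ t → e * u ≡ 1 + o * t
  inverse-of-residue {e} {o} {u} e≥1 u≥1 ec≡1 u≡c = ≡1-mod⇒ℕ (ℕP.*-mono-≤ e≥1 u≥1)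
    (subst (λ z → z ≡ + 1 mod + o) (sym (ℤP.pos-* e u)) (≡-mod-trans (≡-mod-*ˡ (+ e) u≡c) ec≡1))

  InverseMod-of-residue : ∀ {e o π} z {c} → 1 ≤ e → 0< z < + o → z ≡ c mod + o →
    + e ℤ.* c ≡ + 1 mod + o → + 1 ℤ.+ z ≡ + π mod + 2 → InverseMod e o (π % 2)
  InverseMod-of-residue z e≥1 0<z<o z≡c ec≡1 1+z≡π with 0<-<-⇒ℕ 0<z<o
  ... | u , refl , u≥1 , u<o = u , u<o , inverse-of-residue e≥1 u≥1 ec≡1 z≡c , ≡-mod⇒%≡ 2 1+z≡π

  InverseMod-at-odd : ∀ k {n} i → n ≡ 1 + 2 * i → CondAt k n →
    InverseMod (suc n ^ k) (n ^ k) ((n + phase k) % 2)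
  InverseMod-at-odd k {n} i refl cond with parity k
  ... | even j =
    InverseMod-of-residue z (ℕP.m^n>0 (suc n) k) 0<z<nᵏ z≡g (inverse-of-succ-pow k n) (begin
      + 1 ℤ.+ z                   ≈⟨ ≡-mod-+ˡ (+ 1) (≡-mod-+ (odd^≡1-mod-2 i k) (g≡g[1]-mod-2 k (-odd≡1-mod-2 i))) ⟩
      + (1 + (1 + G))             ≈⟨ ≡-mod-sym (≡-mod-2-ℕ (i + j) (lemma i j G)) ⟩
      + (n + phase k)             ∎)
    where
    open import Relation.Binary.Reasoning.Setoid (≡-mod-setoid (+ 2))
    z = + (n ^ k) ℤ.+ g k (ℤ.- + n)
    G = evalℕ (gPoly k) 1
    0<z<nᵏ : 0< z < + (n ^ k)
    0<z<nᵏ = subst (λ N → 0< N ℤ.+ g k (ℤ.- + n) < N) (pos-^ n k) (proj₁ (proj₂ cond (2∣2*i j)))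
    lemma : ∀ i j G → 1 + 2 * i + (1 + 2 * j + G) ≡ 1 + (1 + G) + 2 * (i + j)
    lemma = ℕ-Solver.solve-∀
    lemma′ : ∀ N x → N ℤ.+ x ≡ x ℤ.+ N ℤ.* + 1
    lemma′ = ℤ-Solver.solve-∀
    z≡g : z ≡ g k (ℤ.- + n) mod + (n ^ k)
    z≡g = congruent (+ 1) (lemma′ (+ (n ^ k)) (g k (ℤ.- + n)))
  ... | odd j =
    InverseMod-of-residue (g k (ℤ.- + n)) (ℕP.m^n>0 (suc n) k) 0<g<nᵏ (≡-mod-reflexive refl)
      (inverse-of-succ-pow k n) (begin
      + 1 ℤ.+ g k (ℤ.- + n)       ≈⟨ ≡-mod-+ˡ (+ 1) (g≡g[1]-mod-2 k (-odd≡1-mod-2 i)) ⟩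
      + (1 + G)                   ≈⟨ ≡-mod-sym (≡-mod-2-ℕ (1 + i + j) (lemma i j G)) ⟩
      + (n + phase k)             ∎)
    where
    open import Relation.Binary.Reasoning.Setoid (≡-mod-setoid (+ 2))
    G = evalℕ (gPoly k) 1
    0<g<nᵏ : 0< g k (ℤ.- + n) < + (n ^ k)
    0<g<nᵏ = subst (0< g k (ℤ.- + n) <_) (pos-^ n k) (proj₂ (proj₁ cond (2∤1+2*i j)))
    lemma : ∀ i j G → 1 + 2 * i + (1 + (1 + 2 * j) + G) ≡ 1 + G + 2 * (1 + i + j)
    lemma = ℕ-Solver.solve-∀

  InverseMod-at-even : ∀ k {n} i → n ≡ 2 * i → 1 ≤ n → CondAt k (suc n) →
    InverseMod (n ^ k) (suc n ^ k) ((n + phase k) % 2)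
  InverseMod-at-even k {n} i refl n≥1 cond with parity k
  ... | even j =
    InverseMod-of-residue (g k m) nᵏ≥1 0<g<mᵏ (≡-mod-reflexive (sym (alternate-2* j _))) (inverse-of-pow k n) (begin
      + 1 ℤ.+ g k m               ≈⟨ ≡-mod-+ˡ (+ 1) (g≡g[1]-mod-2 k (odd≡1-mod-2 i)) ⟩
      + (1 + G)                   ≈⟨ ≡-mod-sym (≡-mod-2-ℕ (i + j) (lemma i j G)) ⟩
      + (n + phase k)             ∎)
    where
    open import Relation.Binary.Reasoning.Setoid (≡-mod-setoid (+ 2))
    m = + suc n
    G = evalℕ (gPoly k) 1
    nᵏ≥1 = ℕP.m^n>0 n ⦃ ℕ.>-nonZero n≥1 ⦄ k
    0<g<mᵏ : 0< g k m < + (suc n ^ k)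
    0<g<mᵏ = subst (0< g k m <_) (pos-^ (suc n) k) (proj₂ (proj₂ cond (2∣2*i j)))
    lemma : ∀ i j G → 2 * i + (1 + 2 * j + G) ≡ 1 + G + 2 * (i + j)
    lemma = ℕ-Solver.solve-∀
  ... | odd j =
    InverseMod-of-residue z nᵏ≥1 0<z<mᵏ z≡-g (inverse-of-pow k n) (begin
      + 1 ℤ.+ z                   ≈⟨ ≡-mod-+ˡ (+ 1)
                                     (≡-mod-+ (odd^≡1-mod-2 i k) (≡-mod-neg (g≡g[1]-mod-2 k (odd≡1-mod-2 i)))) ⟩
      + 1 ℤ.+ (+ 1 ℤ.- + G)       ≈⟨ congruent (ℤ.- + G) (lemma′ (+ G)) ⟩
      + (2 + G)                   ≈⟨ ≡-mod-sym (≡-mod-2-ℕ (i + j) (lemma″ i j G)) ⟩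
      + (n + phase k)             ∎)
    where
    open import Relation.Binary.Reasoning.Setoid (≡-mod-setoid (+ 2))
    m = + suc n
    G = evalℕ (gPoly k) 1
    nᵏ≥1 = ℕP.m^n>0 n ⦃ ℕ.>-nonZero n≥1 ⦄ k
    z = + (suc n ^ k) ℤ.- g k m
    0<z<mᵏ : 0< z < + (suc n ^ k)
    0<z<mᵏ = subst (λ M → 0< M ℤ.- g k m < M) (pos-^ (suc n) k) (proj₁ (proj₁ cond (2∤1+2*i j)))
    lemma : ∀ M x → M ℤ.- x ≡ ℤ.- x ℤ.+ M ℤ.* + 1
    lemma = ℤ-Solver.solve-∀
    z≡-g : z ≡ alternate k (g k m) mod + (suc n ^ k)
    z≡-g = congruent (+ 1) (trans (lemma (+ (suc n ^ k)) (g k m))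
                                  (cong (λ x → ℤ.- x ℤ.+ + (suc n ^ k) ℤ.* + 1) (sym (alternate-2* j (g k m)))))
    lemma′ : ∀ G → + 1 ℤ.+ (+ 1 ℤ.- G) ≡ + 2 ℤ.+ G ℤ.+ + 2 ℤ.* ℤ.- G
    lemma′ = ℤ-Solver.solve-∀
    lemma″ : ∀ i j G → 2 * i + (1 + (1 + 2 * j) + G) ≡ 2 + G + 2 * (i + j)
    lemma″ = ℕ-Solver.solve-∀

  Γ-of-InverseMod : ∀ {a b r} → InverseMod a b r → ∃ (λ q → b ≡ 1 + 2 * q) → ΓIs a b (1 + r)
  Γ-of-InverseMod {a} {b} (u , u<b , (t , inverse) , parity) b-odd =
    subst (λ r → ΓIs a b (1 + r)) parity (Γ-of-inverse {a} {b} inverse u<b b-odd)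

  Γ-of-InverseMod-swapped : ∀ {a b r} → InverseMod b a r → ∃ (λ q → a ≡ 1 + 2 * q) → ΓIs a b (1 + r)
  Γ-of-InverseMod-swapped {a} {b} (u , u<a , (t , inverse) , parity) a-odd =
    subst (λ r → ΓIs a b (1 + r)) parity (Γ-of-inverse-swapped {a} {b} inverse u<a a-odd)

  ΓIs-consecutive-powers : ∀ k n → 1 ≤ n → CondAt k n → CondAt k (suc n) →
    ΓIs (n ^ k) (suc n ^ k) (1 + (n + phase k) % 2)
  ΓIs-consecutive-powers k n n≥1 cond[n] cond[1+n] with parity n
  ... | odd i  = Γ-of-InverseMod-swapped {n ^ k} {suc n ^ k} (InverseMod-at-odd k i refl cond[n]) (odd-^ i k)
  ... | even i = Γ-of-InverseMod {n ^ k} {suc n ^ k} (InverseMod-at-even k i refl n≥1 cond[1+n]) (odd-^ i k)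

open import Data.Nat using (_+_; _^_)

even-start : ∀ M c → ∃ λ n₀ → M ≤ n₀ × n₀ ≤ M + 1 × 2 ∣ n₀ + c
even-start M c with 2∣-or-2∣suc (M + c)
... | inj₁ 2∣M+c   = M , ℕP.≤-refl , ℕP.m≤m+n M 1 , 2∣M+c
... | inj₂ 2∣1+M+c = suc M , ℕP.n≤1+n M , ℕP.≤-reflexive (ℕP.+-comm 1 M) , 2∣1+M+c

[n+c]%2≡[n∸n₀]%2 : ∀ {n n₀ c} → n₀ ≤ n → 2 ∣ n₀ + c → (n + c) % 2 ≡ (n ∸ n₀) % 2
[n+c]%2≡[n∸n₀]%2 {n} {n₀} {c} n₀≤n 2∣n₀+c with ℕP.m≤n⇒∃[o]m+o≡n n₀≤n
... | d , refl = begin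
  (n₀ + d + c) % 2   ≡⟨ cong (_% 2) (trans (cong (_+ c) (ℕP.+-comm n₀ d)) (ℕP.+-assoc d n₀ c)) ⟩
  (d + (n₀ + c)) % 2 ≡⟨ %-remove-+ʳ d 2∣n₀+c ⟩
  d % 2              ≡⟨ cong (_% 2) (ℕP.m+n∸m≡n n₀ d) ⟨
  (n₀ + d ∸ n₀) % 2  ∎
  where open ≡-Reasoning

theorem1p3 : (k : ℕ) → 1 ≤ k →
    Σ ℕ λ M → IsM k M ×
      Σ ℕ λ n₀ → n₀ ≤ M + 1 × 1 ≤ n₀ ×
        (∀ n → n₀ ≤ n → ΓIs (n ^ k) ((n + 1) ^ k) (1 + (n ∸ n₀) % 2))
theorem1p3 k k≥1 with least-tail (CondAt? k) (evalℕ (gPoly k) 1) (λ n → CondAt-eventually k n k≥1)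
... | M , M≥1 , cond , least with even-start M (phase k)
... | n₀ , M≤n₀ , n₀≤M+1 , 2∣n₀+phase =
  M , (M≥1 , cond , least) , n₀ , n₀≤M+1 , ℕP.≤-trans M≥1 M≤n₀ , alternation
  where
  alternation : ∀ n → n₀ ≤ n → ΓIs (n ^ k) ((n + 1) ^ k) (1 + (n ∸ n₀) % 2)
  alternation n n₀≤n =
    subst₂ (λ m v → ΓIs (n ^ k) (m ^ k) v) (ℕP.+-comm 1 n)
           (cong suc ([n+c]%2≡[n∸n₀]%2 n₀≤n 2∣n₀+phase))
      (ΓIs-consecutive-powers k n (ℕP.≤-trans M≥1 M≤n) (cond n M≤n) (cond (suc n) (ℕP.m≤n⇒m≤1+n M≤n)))
    where
    M≤n = ℕP.≤-trans M≤n₀ n₀≤n
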